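{- For $n=3$ and for $n=4$, there are infinitely many CS $n$-sets whose elements are pairwise distinct.
   Context: A CS-set is a finite multiset $\langle a_1,\dots,a_n\rangle$ of integers (repeated elements allowed, order irrelevant) such that $a_1^3+a_2^3+\cdots+a_n^3=(a_1+a_2+\cdots+a_n)^2$, where it is required that no $a_i$ equals $0$ and that the multiset does not contain both $k$ and $-k$ for any integer $k$. A CS $n$-set is a CS-set with exactly $n$ elements (counted with multiplicity); entries may be negative. -}

module Defs where

open import Data.Nat using (ℕ)
open import Data.Integer using (ℤ; _+_; _*_; -_; 0ℤ)
open import Data.Vec using (Vec; toList; foldr)
open import Data.List using (List)
open import Data.List.Membership.Propositional using (_∈_)
open import Data.List.Relation.Unary.Unique.Propositional using (Unique)
open import Data.List.Relation.Binary.Permutation.Propositional using (_↭_)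
open import Data.List.Relation.Unary.Any using (Any)
open import Data.Product using (_×_)
open import Relation.Binary.PropositionalEquality using (_≡_)
open import Relation.Nullary using (¬_)

-- A multiset of n integers is represented by a vector of length n,
-- considered up to permutation (see _≈ₘ_ below).

sumℤ : ∀ {n} → Vec ℤ n → ℤ
sumℤ = foldr _ _+_ 0ℤ

cube : ℤ → ℤ
cube x = x * x * x

sumCubes : ∀ {n} → Vec ℤ n → ℤ
sumCubes = foldr _ (λ x acc → cube x + acc) 0ℤ

IsCSSet : ∀ {n} → Vec ℤ n → Set
IsCSSet v =
  (¬ (0ℤ ∈ toList v)) ×
  (∀ k → k ∈ toList v → ¬ ((- k) ∈ toList v)) ×
  (sumCubes v ≡ sumℤ v * sumℤ v)

Distinct : ∀ {n} → Vec ℤ n → Set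
Distinct v = Unique (toList v)

_≈ₘ_ : ∀ {n} → Vec ℤ n → Vec ℤ n → Set
v ≈ₘ w = toList v ↭ toList w

-- "There are infinitely many CS n-sets with pairwise distinct elements":
-- for every finite list of multisets, there is such a CS n-set not
-- (as a multiset) among them.
InfinitelyManyDistinctCS : ℕ → Set
InfinitelyManyDistinctCS n =
  (L : List (Vec ℤ n)) →
  Data.Product.∃ λ (v : Vec ℤ n) →
    IsCSSet v × Distinct v × ¬ Any (λ w → v ≈ₘ w) L

{-# OPTIONS --safe #-}
-- Scaling a vector by t multiplies the sum of cubes by t³ but the square of
-- the sum only by t², so a vector s with Σs ≠ 0 becomes a CS set after
-- scaling by any t with t·Σs³ = (Σs)²; if the absolute values of the entries
-- of s are distinct and nonzero, the scaled entries are distinct and contain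
-- no pair k, −k. Ramanujan's identity (9M⁴)³ = (9M⁴ − 3M)³ + (9M³ − 1)³ + 1
-- yields such seeds (a, −b, −c) with Σs³ = 1 and (a, −b, −c, 1) with Σs³ = 2.
-- As x³ ≡ x (mod 6), Σs is then ≡ 1 resp. 2 (mod 6): nonzero, and even in
-- the second case, so t = (Σs)² resp. t = (Σs)²/2 works. The largest entry
-- grows with M, which gives infinitely many sets.
module Submission where

open import Defs
open import Data.Product using (_×_; _,_)
open import Data.Sum using (reduce)
open import Function using (_on_; _∘_; flip; it)
open import Data.Nat as ℕ using (ℕ; suc; _<_; _≤_; s≤s; z≤n; z<s; s<s)
import Data.Nat.Properties as ℕP
import Data.Nat.Divisibility as ℕD
open import Data.Nat.ListAction using (sum)
open import Data.Integer as ℤ using (ℤ; +_; -_; 0ℤ; 1ℤ; ∣_∣; NonZero)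
import Data.Integer.Properties as ℤP
open import Data.Integer.DivMod using (_%ℕ_; _/ℕ_; n%ℕd<d; a≡a%ℕn+[a/ℕn]*n)
open import Data.Integer.Divisibility.Signed
  using ( _∣_; divides; quotient; ∣-refl; ∣-trans; ∣⇒∣ᵤ; ∣m∣n⇒∣m+n; ∣m∣n⇒∣m-n; ∣n⇒∣m*n
        ; module ∣-Reasoning)
open import Data.Vec using (Vec; []; _∷_; map; head; toList)
open import Data.Vec.Properties using (toList-map)
open import Data.List as List using (List; []; _∷_)
open import Data.List.Membership.Propositional using (_∈_; _∉_; find)
open import Data.List.Membership.Propositional.Properties using (∈-map⁺)
open import Data.List.Relation.Unary.Any using (Any; here; there)
open import Data.List.Relation.Unary.All as All using (All; []; _∷_)
import Data.List.Relation.Unary.All.Properties as All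
open import Data.List.Relation.Unary.AllPairs as AllPairs using (AllPairs; []; _∷_)
import Data.List.Relation.Unary.AllPairs.Properties as AllPairs
open import Data.List.Relation.Unary.Linked using (Linked; [-]; _∷_)
open import Data.List.Relation.Unary.Linked.Properties using (Linked⇒AllPairs)
open import Data.List.Relation.Unary.Unique.Propositional using (Unique)
open import Data.List.Relation.Binary.Permutation.Propositional.Properties using (∈-resp-↭)
open import Relation.Binary.PropositionalEquality
open import Relation.Nullary using (¬_)
import Data.Nat.Tactic.RingSolver as ℕ-Solver
import Data.Integer.Tactic.RingSolver as ℤ-Solver

module _ where
  open import Data.Nat using (_+_; _*_)
  open ℕ-Solver using (solve-∀)

  infix 8 _³
  _³ : ℕ → ℕ
  n ³ = n * n * n

  -- With u = 3M³ − 1 these are 9M⁴, 9M⁴ − 3M and 9M³ − 1.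
  ramA ramB : ℕ → ℕ → ℕ
  ramA M u = 3 * M * (1 + u)
  ramB M u = 3 * M * u

  ramC : ℕ → ℕ
  ramC u = 2 + 3 * u

  ramanujanℕ : ∀ M u → 1 + u ≡ 3 * M ³ → ramA M u ³ ≡ ramB M u ³ + ramC u ³ + 1
  ramanujanℕ M u 1+u≡3M³ = begin
    (3 * M * (1 + u)) ³                      ≡⟨ scale³ M (1 + u) ⟩
    9 * (3 * M ³) * (1 + u) ³                ≡⟨ cong (λ v → 9 * v * (1 + u) ³) 1+u≡3M³ ⟨
    9 * (1 + u) * (1 + u) ³                  ≡⟨ expand u ⟩
    9 * (1 + u) * u ³ + (2 + 3 * u) ³ + 1    ≡⟨ cong (λ v → 9 * v * u ³ + (2 + 3 * u) ³ + 1) 1+u≡3M³ ⟩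
    9 * (3 * M ³) * u ³ + (2 + 3 * u) ³ + 1  ≡⟨ cong (λ v → v + (2 + 3 * u) ³ + 1) (scale³ M u) ⟨
    (3 * M * u) ³ + (2 + 3 * u) ³ + 1        ∎
    where
    open ≡-Reasoning
    scale³ : ∀ M w → (3 * M * w) * (3 * M * w) * (3 * M * w) ≡ 9 * (3 * (M * M * M)) * (w * w * w)
    scale³ = solve-∀
    expand : ∀ u → 9 * (1 + u) * ((1 + u) * (1 + u) * (1 + u))
                   ≡ 9 * (1 + u) * (u * u * u) + (2 + 3 * u) * (2 + 3 * u) * (2 + 3 * u) + 1
    expand = solve-∀

  ramC<ramB : ∀ M u → 2 ≤ M → 1 ≤ u → ramC u < ramB M u
  ramC<ramB M u 2≤M 1≤u = begin-strict
    2 + 3 * u       <⟨ ℕP.n<1+n _ ⟩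
    3 + 3 * u       ≤⟨ ℕP.+-monoˡ-≤ (3 * u) (ℕP.*-monoʳ-≤ 3 1≤u) ⟩
    3 * u + 3 * u   ≡⟨ double u ⟩
    3 * 2 * u       ≤⟨ ℕP.*-monoˡ-≤ u (ℕP.*-monoʳ-≤ 3 2≤M) ⟩
    3 * M * u       ∎
    where
    open ℕP.≤-Reasoning
    double : ∀ u → 3 * u + 3 * u ≡ 3 * 2 * u
    double = solve-∀

  ramB<ramA : ∀ M u → .{{ℕ.NonZero M}} → ramB M u < ramA M u
  ramB<ramA M u = ℕP.*-monoʳ-< (3 * M) {{ℕP.m*n≢0 3 M}} (ℕP.n<1+n u)

  M≤ramA : ∀ M u → M ≤ ramA M u
  M≤ramA M u = ℕP.≤-trans (ℕP.m≤n*m M 3) (ℕP.m≤m*n (3 * M) (1 + u))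

open import Data.Integer using (_+_; _-_; _*_)
open ℤ-Solver using (solve-∀)

+-³ : ∀ n → + (n ³) ≡ cube (+ n)
+-³ n = trans (ℤP.pos-* (n ℕ.* n) n) (cong (_* + n) (ℤP.pos-* n n))

ramanujan : ∀ M u → 1 ℕ.+ u ≡ 3 ℕ.* M ³ →
            cube (+ ramA M u) ≡ cube (+ ramB M u) + cube (+ ramC u) + 1ℤ
ramanujan M u 1+u≡3M³ = begin
  cube (+ A)                    ≡⟨ +-³ A ⟨
  + (A ³)                       ≡⟨ cong +_ (ramanujanℕ M u 1+u≡3M³) ⟩
  + (B ³ ℕ.+ C ³ ℕ.+ 1)         ≡⟨ ℤP.pos-+ (B ³ ℕ.+ C ³) 1 ⟩
  + (B ³ ℕ.+ C ³) + 1ℤ          ≡⟨ cong (_+ 1ℤ) (ℤP.pos-+ (B ³) (C ³)) ⟩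
  + (B ³) + + (C ³) + 1ℤ        ≡⟨ cong₂ (λ x y → x + y + 1ℤ) (+-³ B) (+-³ C) ⟩
  cube (+ B) + cube (+ C) + 1ℤ  ∎
  where
  open ≡-Reasoning
  A = ramA M u
  B = ramB M u
  C = ramC u

sumCubes-seed : ∀ {n x y z} (ws : Vec ℤ n) → cube x ≡ cube y + cube z + 1ℤ →
                sumCubes (x ∷ - y ∷ - z ∷ ws) ≡ 1ℤ + sumCubes ws
sumCubes-seed {x = x} {y} {z} ws x³≡y³+z³+1 = begin
  sumCubes (x ∷ - y ∷ - z ∷ ws)                            ≡⟨ regroup x y z (sumCubes ws) ⟩
  cube x - (cube y + cube z) + sumCubes ws
    ≡⟨ cong (λ v → v - (cube y + cube z) + sumCubes ws) x³≡y³+z³+1 ⟩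
  cube y + cube z + 1ℤ - (cube y + cube z) + sumCubes ws   ≡⟨ cancel (cube y + cube z) (sumCubes ws) ⟩
  1ℤ + sumCubes ws                                         ∎
  where
  open ≡-Reasoning
  regroup : ∀ x y z s → x * x * x + ((- y) * (- y) * (- y) + ((- z) * (- z) * (- z) + s))
                        ≡ x * x * x - (y * y * y + z * z * z) + s
  regroup = solve-∀
  cancel : ∀ p s → p + 1ℤ - p + s ≡ 1ℤ + s
  cancel = solve-∀

6∣x³-x : ∀ x → + 6 ∣ cube x - x
6∣x³-x x = subst (λ y → + 6 ∣ cube y - y) (sym (a≡a%ℕn+[a/ℕn]*n x 6))
                      (residue (x %ℕ 6) (x /ℕ 6) (n%ℕd<d x 6))
  where
  small : ∀ r → r < 6 → + 6 ∣ cube (+ r) - + r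
  small 0 _ = divides 0ℤ refl
  small 1 _ = divides 0ℤ refl
  small 2 _ = divides 1ℤ refl
  small 3 _ = divides (+ 4) refl
  small 4 _ = divides (+ 10) refl
  small 5 _ = divides (+ 20) refl
  small (suc (suc (suc (suc (suc (suc _)))))) (s≤s (s≤s (s≤s (s≤s (s≤s (s≤s ()))))))
  expand : ∀ r q → (r + q * + 6) * (r + q * + 6) * (r + q * + 6) - (r + q * + 6)
                   ≡ (r * r * r - r) + (+ 3 * r * r * q + + 18 * r * q * q + + 36 * q * q * q - q) * + 6
  expand = solve-∀
  shift : ∀ r q → + 6 ∣ cube r - r → + 6 ∣ cube (r + q * + 6) - (r + q * + 6)
  shift r q 6∣r³-r = begin
    + 6                                   ∣⟨ ∣m∣n⇒∣m+n 6∣r³-r (∣n⇒∣m*n Q ∣-refl) ⟩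
    (cube r - r) + Q * + 6                ≡⟨ expand r q ⟨
    cube (r + q * + 6) - (r + q * + 6)    ∎
    where
    open ∣-Reasoning
    Q = + 3 * r * r * q + + 18 * r * q * q + + 36 * q * q * q - q
  residue : ∀ r q → r < 6 → + 6 ∣ cube (+ r + q * + 6) - (+ r + q * + 6)
  residue r q r<6 = shift (+ r) q (small r r<6)

6∣sumCubes-sumℤ : ∀ {n} (v : Vec ℤ n) → + 6 ∣ sumCubes v - sumℤ v
6∣sumCubes-sumℤ []      = divides 0ℤ refl
6∣sumCubes-sumℤ (x ∷ v) =
  subst (+ 6 ∣_) (sym (regroup x (sumCubes v) (sumℤ v))) (∣m∣n⇒∣m+n (6∣x³-x x) (6∣sumCubes-sumℤ v))
  where
  regroup : ∀ x S s → x * x * x + S - (x + s) ≡ (x * x * x - x) + (S - s)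
  regroup = solve-∀

6∤ : ∀ {d} .{{_ : ℕ.NonZero d}} → d < 6 → ¬ + 6 ∣ + d
6∤ d<6 6∣d = ℕP.<⇒≱ d<6 (ℕD.∣⇒≤ (∣⇒∣ᵤ 6∣d))

sumℤ≢0 : ∀ {n} (v : Vec ℤ n) → ¬ + 6 ∣ sumCubes v → sumℤ v ≢ 0ℤ
sumℤ≢0 v 6∤Σx³ Σx≡0 = 6∤Σx³ (begin
  + 6                    ∣⟨ 6∣sumCubes-sumℤ v ⟩
  sumCubes v - sumℤ v    ≡⟨ cong (λ σ → sumCubes v - σ) Σx≡0 ⟩
  sumCubes v - 0ℤ        ≡⟨ ℤP.+-identityʳ (sumCubes v) ⟩
  sumCubes v             ∎)
  where open ∣-Reasoning

2∣sumℤ : ∀ {n} (v : Vec ℤ n) → + 2 ∣ sumCubes v → + 2 ∣ sumℤ v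
2∣sumℤ v 2∣Σx³ = begin
  + 2                                   ∣⟨ ∣m∣n⇒∣m-n 2∣Σx³ (∣-trans 2∣6 (6∣sumCubes-sumℤ v)) ⟩
  sumCubes v - (sumCubes v - sumℤ v)    ≡⟨ cancel (sumCubes v) (sumℤ v) ⟩
  sumℤ v                                ∎
  where
  open ∣-Reasoning
  2∣6 : + 2 ∣ + 6
  2∣6 = divides (+ 3) refl
  cancel : ∀ S s → S - (S - s) ≡ s
  cancel = solve-∀

sumℤ-map-* : ∀ {n} t (v : Vec ℤ n) → sumℤ (map (t *_) v) ≡ t * sumℤ v
sumℤ-map-* t []      = sym (ℤP.*-zeroʳ t)
sumℤ-map-* t (x ∷ v) =
  trans (cong (λ s → t * x + s) (sumℤ-map-* t v)) (sym (ℤP.*-distribˡ-+ t x (sumℤ v)))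

sumCubes-map-* : ∀ {n} t (v : Vec ℤ n) → sumCubes (map (t *_) v) ≡ cube t * sumCubes v
sumCubes-map-* t []      = sym (ℤP.*-zeroʳ (cube t))
sumCubes-map-* t (x ∷ v) =
  trans (cong (λ s → cube (t * x) + s) (sumCubes-map-* t v)) (factor t x (sumCubes v))
  where
  factor : ∀ t x s → (t * x) * (t * x) * (t * x) + t * t * t * s ≡ t * t * t * (x * x * x + s)
  factor = solve-∀

map-*-cubes≡square : ∀ {n} t (v : Vec ℤ n) → t * sumCubes v ≡ sumℤ v * sumℤ v →
  sumCubes (map (t *_) v) ≡ sumℤ (map (t *_) v) * sumℤ (map (t *_) v)
map-*-cubes≡square t v balanced = begin
  sumCubes (map (t *_) v)                        ≡⟨ sumCubes-map-* t v ⟩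
  t * t * t * sumCubes v                         ≡⟨ ℤP.*-assoc (t * t) t (sumCubes v) ⟩
  t * t * (t * sumCubes v)                       ≡⟨ cong (t * t *_) balanced ⟩
  t * t * (sumℤ v * sumℤ v)                      ≡⟨ regroup t (sumℤ v) ⟩
  t * sumℤ v * (t * sumℤ v)                      ≡⟨ cong₂ _*_ (sumℤ-map-* t v) (sumℤ-map-* t v) ⟨
  sumℤ (map (t *_) v) * sumℤ (map (t *_) v)      ∎
  where
  open ≡-Reasoning
  regroup : ∀ t s → t * t * (s * s) ≡ t * s * (t * s)
  regroup = solve-∀

AbsDecreasing : List ℤ → Set
AbsDecreasing = AllPairs (ℕ._>_ on ∣_∣)

linked⇒absDecreasing : ∀ {xs} → Linked (ℕ._>_ on ∣_∣) xs → AbsDecreasing xs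
linked⇒absDecreasing = Linked⇒AllPairs (flip ℕP.<-trans)

absDecreasing⇒unique : ∀ {xs} → AbsDecreasing xs → Unique xs
absDecreasing⇒unique = AllPairs.map λ ∣x∣>∣y∣ x≡y → ℕP.<-irrefl (cong ∣_∣ (sym x≡y)) ∣x∣>∣y∣

nonZero⇒0∉ : ∀ {xs} → All NonZero xs → 0ℤ ∉ xs
nonZero⇒0∉ nonZero 0∈xs = ℕ.≢-nonZero⁻¹ 0 {{All.lookup nonZero 0∈xs}} refl

-i≢i : ∀ i → NonZero i → - i ≢ i
-i≢i ℤ.+[1+ n ] _ ()
-i≢i ℤ.-[1+ n ] _ ()

noOpposites : ∀ {xs} → All NonZero xs → AbsDecreasing xs → ∀ {k} → k ∈ xs → - k ∉ xs
noOpposites (k≢0 ∷ _) _ {k} (here refl) (here -k≡k) = -i≢i k k≢0 -k≡k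
noOpposites _ (∣k∣>∣xs∣ ∷ _) {k} (here refl) (there -k∈xs) =
  ℕP.<-irrefl (ℤP.∣-i∣≡∣i∣ k) (All.lookup ∣k∣>∣xs∣ -k∈xs)
noOpposites _ (∣-k∣>∣xs∣ ∷ _) {k} (there k∈xs) (here refl) =
  ℕP.<-irrefl (sym (ℤP.∣-i∣≡∣i∣ k)) (All.lookup ∣-k∣>∣xs∣ k∈xs)
noOpposites (_ ∷ nonZero) (_ ∷ dec) (there k∈xs) (there -k∈xs) = noOpposites nonZero dec k∈xs -k∈xs

∣x∣≤∣t*x∣ : ∀ t x .{{_ : NonZero t}} → ∣ x ∣ ≤ ∣ t * x ∣
∣x∣≤∣t*x∣ t x = subst (∣ x ∣ ≤_) (sym (ℤP.abs-* t x)) (ℕP.m≤n*m ∣ x ∣ ∣ t ∣)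

absDecreasing-map-* : ∀ t .{{_ : NonZero t}} {xs} →
                      AbsDecreasing xs → AbsDecreasing (List.map (t *_) xs)
absDecreasing-map-* t = AllPairs.map⁺ ∘ AllPairs.map scale
  where
  scale : ∀ {x y} → ∣ y ∣ < ∣ x ∣ → ∣ t * y ∣ < ∣ t * x ∣
  scale {x} {y} ∣y∣<∣x∣ =
    subst₂ _<_ (sym (ℤP.abs-* t y)) (sym (ℤP.abs-* t x)) (ℕP.*-monoʳ-< ∣ t ∣ ∣y∣<∣x∣)

nonZero-map-* : ∀ t .{{_ : NonZero t}} {xs} → All NonZero xs → All NonZero (List.map (t *_) xs)
nonZero-map-* t = All.map⁺ ∘ All.map (λ {x} x≢0 → ℤP.i*j≢0 t x {{it}} {{x≢0}})

bound : ∀ {n} → List (Vec ℤ n) → ℕ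
bound = sum ∘ List.map (sum ∘ List.map ∣_∣ ∘ toList)

∈⇒≤sum : ∀ {m ms} → m ∈ ms → m ≤ sum ms
∈⇒≤sum (here refl) = ℕP.m≤m+n _ _
∈⇒≤sum (there m∈ms) = ℕP.≤-trans (∈⇒≤sum m∈ms) (ℕP.m≤n+m _ _)

∉-bound : ∀ {n} (L : List (Vec ℤ n)) {v x} → x ∈ toList v → bound L < ∣ x ∣ → ¬ Any (v ≈ₘ_) L
∉-bound L x∈v L<∣x∣ v≈L with find v≈L
... | w , w∈L , v≈w = ℕP.<⇒≱ L<∣x∣ (ℕP.≤-trans
  (∈⇒≤sum (∈-map⁺ ∣_∣ (∈-resp-↭ v≈w x∈v)))
  (∈⇒≤sum (∈-map⁺ (sum ∘ List.map ∣_∣ ∘ toList) w∈L)))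

map-*-∉-bound : ∀ {n} (L : List (Vec ℤ (suc n))) t .{{_ : NonZero t}} (v : Vec ℤ (suc n)) →
                bound L < ∣ head v ∣ → ¬ Any (map (t *_) v ≈ₘ_) L
map-*-∉-bound L t (x ∷ _) L<∣x∣ = ∉-bound L (here refl) (ℕP.<-≤-trans L<∣x∣ (∣x∣≤∣t*x∣ t x))

record CSSeed (n : ℕ) : Set where
  field
    entries               : Vec ℤ n
    scale                 : ℤ
    entries-nonZero       : All NonZero (toList entries)
    entries-absDecreasing : AbsDecreasing (toList entries)
    sum≢0                 : sumℤ entries ≢ 0ℤ
    balanced              : scale * sumCubes entries ≡ sumℤ entries * sumℤ entries

  csSet : Vec ℤ n
  csSet = map (scale *_) entries

  scale-nonZero : NonZero scale
  scale-nonZero = ℤ.≢-nonZero {scale} λ scale≡0 →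
    sum≢0 (reduce (ℤP.i*j≡0⇒i≡0∨j≡0 (sumℤ entries) (σ*σ≡0 scale≡0)))
    where
    open ≡-Reasoning
    σ*σ≡0 : scale ≡ 0ℤ → sumℤ entries * sumℤ entries ≡ 0ℤ
    σ*σ≡0 scale≡0 = begin
      sumℤ entries * sumℤ entries   ≡⟨ balanced ⟨
      scale * sumCubes entries      ≡⟨ cong (_* sumCubes entries) scale≡0 ⟩
      0ℤ * sumCubes entries         ≡⟨ ℤP.*-zeroˡ (sumCubes entries) ⟩
      0ℤ                            ∎

  csSet-nonZero : All NonZero (toList csSet)
  csSet-nonZero = subst (All NonZero) (sym (toList-map (scale *_) entries))
                        (nonZero-map-* scale {{scale-nonZero}} entries-nonZero)

  csSet-absDecreasing : AbsDecreasing (toList csSet)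
  csSet-absDecreasing = subst AbsDecreasing (sym (toList-map (scale *_) entries))
                              (absDecreasing-map-* scale {{scale-nonZero}} entries-absDecreasing)

  csSet-isCSSet : IsCSSet csSet
  csSet-isCSSet = nonZero⇒0∉ csSet-nonZero
                , (λ _ → noOpposites csSet-nonZero csSet-absDecreasing)
                , map-*-cubes≡square scale entries balanced

  csSet-distinct : Distinct csSet
  csSet-distinct = absDecreasing⇒unique csSet-absDecreasing

cubeSum1-seed : ∀ {n} (v : Vec ℤ n) → All NonZero (toList v) → AbsDecreasing (toList v) →
                sumCubes v ≡ 1ℤ → CSSeed n
cubeSum1-seed v nonZero dec Σx³≡1 = record
  { entries               = v
  ; scale                 = σ * σ
  ; entries-nonZero       = nonZero
  ; entries-absDecreasing = dec
  ; sum≢0                 = sumℤ≢0 v (6∤ (s<s z<s) ∘ subst (+ 6 ∣_) Σx³≡1)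
  ; balanced              = trans (cong (σ * σ *_) Σx³≡1) (ℤP.*-identityʳ (σ * σ))
  }
  where σ = sumℤ v

cubeSum2-seed : ∀ {n} (v : Vec ℤ n) → All NonZero (toList v) → AbsDecreasing (toList v) →
                sumCubes v ≡ + 2 → CSSeed n
cubeSum2-seed v nonZero dec Σx³≡2 = record
  { entries               = v
  ; scale                 = ρ * ρ * + 2
  ; entries-nonZero       = nonZero
  ; entries-absDecreasing = dec
  ; sum≢0                 = sumℤ≢0 v (6∤ (s<s (s<s z<s)) ∘ subst (+ 6 ∣_) Σx³≡2)
  ; balanced              = begin
      ρ * ρ * + 2 * sumCubes v   ≡⟨ cong (ρ * ρ * + 2 *_) Σx³≡2 ⟩
      ρ * ρ * + 2 * + 2          ≡⟨ regroup ρ ⟩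
      ρ * + 2 * (ρ * + 2)        ≡⟨ cong₂ _*_ σ≡ρ*2 σ≡ρ*2 ⟨
      σ * σ                      ∎
  }
  where
  open ≡-Reasoning
  σ = sumℤ v
  2∣σ : + 2 ∣ σ
  2∣σ = 2∣sumℤ v (subst (+ 2 ∣_) (sym Σx³≡2) ∣-refl)
  ρ = quotient 2∣σ
  σ≡ρ*2 : σ ≡ ρ * + 2
  σ≡ρ*2 = _∣_.equality 2∣σ
  regroup : ∀ r → r * r * + 2 * + 2 ≡ r * + 2 * (r * + 2)
  regroup = solve-∀

infinitelyMany : ∀ {n} (seed : ℕ → CSSeed (suc n)) →
                 (∀ k → k < ∣ head (CSSeed.entries (seed k)) ∣) → InfinitelyManyDistinctCS (suc n)
infinitelyMany seed grows L =
  csSet , csSet-isCSSet , csSet-distinct , map-*-∉-bound L scale {{scale-nonZero}} entries (grows (bound L))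
  where open CSSeed (seed (bound L))

-- 3 * M ³, b and c reduce to successors, so 1 + u is definitionally 3 * M ³,
-- ∣ - + b ∣ is b, and the NonZero proofs below are trivial.
module RamanujanSeed (k : ℕ) where
  M u a b c : ℕ
  M = 2 ℕ.+ k
  u = ℕ.pred (3 ℕ.* M ³)
  a = ramA M u
  b = ramB M u
  c = ramC u

  k<a : k < a
  k<a = ℕP.<-≤-trans (ℕP.m<n+m k z<s) (M≤ramA M u)

  a³≡b³+c³+1 : cube (+ a) ≡ cube (+ b) + cube (+ c) + 1ℤ
  a³≡b³+c³+1 = ramanujan M u refl

  c<b : c < b
  c<b = ramC<ramB M u (s≤s (s≤s z≤n)) (s≤s z≤n)

  b<a : b < a
  b<a = ramB<ramA M u

  entries₃ : Vec ℤ 3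
  entries₃ = + a ∷ - + b ∷ - + c ∷ []

  seed₃ : CSSeed 3
  seed₃ = cubeSum1-seed entries₃ (_ ∷ _ ∷ _ ∷ [])
                        (linked⇒absDecreasing (b<a ∷ c<b ∷ [-]))
                        (sumCubes-seed {x = + a} {+ b} {+ c} [] a³≡b³+c³+1)

  entries₄ : Vec ℤ 4
  entries₄ = + a ∷ - + b ∷ - + c ∷ 1ℤ ∷ []

  seed₄ : CSSeed 4
  seed₄ = cubeSum2-seed entries₄ (_ ∷ _ ∷ _ ∷ _ ∷ [])
                        (linked⇒absDecreasing (b<a ∷ c<b ∷ s≤s (s≤s z≤n) ∷ [-]))
                        (sumCubes-seed {x = + a} {+ b} {+ c} (1ℤ ∷ []) a³≡b³+c³+1)

proposition10 : InfinitelyManyDistinctCS 3 × InfinitelyManyDistinctCS 4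
proposition10 = infinitelyMany RamanujanSeed.seed₃ RamanujanSeed.k<a
              , infinitelyMany RamanujanSeed.seed₄ RamanujanSeed.k<a
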